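{- Let $H=\mathbb{Z}_{k_s}^{\alpha_s}\times\dots\times\mathbb{Z}_{k_1}^{\alpha_1}$ with $2\le k_1<\dots<k_s$ and positive integers $\alpha_j$, equipped with the Hamming distance, and let $d$ be a positive integer. Let $C\subseteq H$ be a Hamming packing with minimum distance $d$. Then there exists a Hamming packing $C'\subseteq H$ with $|C'|=|C|$ and the same minimum distance $d$ whose contact graph $CG(C')$ is connected.
   Context: Elements of $H$ (words) are written as strings $w=(w[1],\dots,w[n])$, $n=\sum_j\alpha_j$. The Hamming distance is $d(w,x)=|\{j: w[j]\neq x[j]\}|$. The minimum distance of a code $C\subseteq H$ is $\min\{d(w,x): w,x\in C, w\neq x\}$. A Hamming packing with minimum distance $d$ is a code of maximal cardinality among all codes in $H$ with minimum distance $d$. The contact graph $CG(C)$ of a code $C$ with minimum distance $d$ is the graph whose vertex set is $C$, with an edge between $a,b\in C$ if and only if $d(a,b)=d$. -}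

module Defs where

open import Data.Nat using (ℕ; zero; suc; _+_; _≤_; _<_; _≥_)
open import Data.Fin using (Fin; toℕ)
open import Data.Product using (Σ; _×_; _,_; ∃; ∃-syntax)
open import Data.List using (List; []; _∷_; length)
open import Data.List.Membership.Propositional using (_∈_)
open import Data.List.Relation.Unary.Unique.Propositional using (Unique)
open import Data.List.Relation.Unary.All using (All)
open import Relation.Binary.PropositionalEquality using (_≡_)
open import Relation.Nullary using (¬_; yes; no)
import Data.Fin as F

Σfin : (n : ℕ) → (Fin n → ℕ) → ℕ
Σfin zero f = 0
Σfin (suc n) f = f F.zero + Σfin n (λ i → f (F.suc i))

-- The space H = Z_{k_s}^{α_s} × ... × Z_{k_1}^{α_1}, described by
-- s blocks; block i has α i coordinates, each with alphabet Z_{k i} ≅ Fin (k i).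
Word : (s : ℕ) (k α : Fin s → ℕ) → Set
Word s k α = (i : Fin s) → Fin (α i) → Fin (k i)

diffCount : (m : ℕ) {A : Fin m → Set} →
            ((t : Fin m) → (x y : A t) → Relation.Nullary.Dec (x ≡ y)) →
            ((t : Fin m) → A t) → ((t : Fin m) → A t) → ℕ
diffCount m dec w x = Σfin m (λ t → indicator (dec t (w t) (x t)))
  where
  indicator : ∀ {P : Set} → Relation.Nullary.Dec P → ℕ
  indicator (yes _) = 0
  indicator (no _)  = 1

hamming : {s : ℕ} {k α : Fin s → ℕ} → Word s k α → Word s k α → ℕ
hamming {s} {k} {α} w x =
  Σfin s (λ i → diffCount (α i) (λ _ → F._≟_) (w i) (x i))

record Code (s : ℕ) (k α : Fin s → ℕ) : Set where
  constructor code
  field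
    elems  : List (Word s k α)
    unique : Unique elems
open Code public

card : {s : ℕ} {k α : Fin s → ℕ} → Code s k α → ℕ
card C = length (elems C)

HasMinDist : {s : ℕ} {k α : Fin s → ℕ} → Code s k α → ℕ → Set
HasMinDist {s} {k} {α} C d =
  ((w x : Word s k α) → w ∈ elems C → x ∈ elems C → ¬ (w ≡ x) → d ≤ hamming w x)
  × (∃[ w ] ∃[ x ] (w ∈ elems C × x ∈ elems C × ¬ (w ≡ x) × hamming w x ≡ d))

IsHammingPacking : {s : ℕ} {k α : Fin s → ℕ} → Code s k α → ℕ → Set
IsHammingPacking {s} {k} {α} C d =
  HasMinDist C d × ((D : Code s k α) → HasMinDist D d → card D ≤ card C)

ContactEdge : {s : ℕ} {k α : Fin s → ℕ} → Code s k α → ℕ →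
              Word s k α → Word s k α → Set
ContactEdge C d a b = a ∈ elems C × b ∈ elems C × hamming a b ≡ d

data Walk {s : ℕ} {k α : Fin s → ℕ} (C : Code s k α) (d : ℕ) :
          Word s k α → Word s k α → Set where
  here : ∀ {a} → a ∈ elems C → Walk C d a a
  step : ∀ {a b c} → ContactEdge C d a b → Walk C d b c → Walk C d a c

ContactGraphConnected : {s : ℕ} {k α : Fin s → ℕ} → Code s k α → ℕ → Set
ContactGraphConnected {s} {k} {α} C d =
  (a b : Word s k α) → a ∈ elems C → b ∈ elems C → Walk C d a b

-- Permuting the symbols of a single coordinate is an isometry of H. Grow a
-- connected subcode B of C word by word. If no remaining word is at distance
-- exactly d from B, every remaining word is at distance > d from B; pick c
-- among them, b ∈ B and a coordinate j with c[j] ≠ b[j], and apply to all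
-- remaining words the transposition of the symbols c[j] and b[j] at
-- coordinate j. The remaining words stay pairwise at distance ≥ d, their
-- distances to B drop by at most one (so stay ≥ d), and d(c, b) strictly
-- decreases; hence after finitely many steps some remaining word touches B and
-- joins it. The final code has |C| words and minimum distance ≥ d, so it is
-- again a packing; being connected with at least two words, it attains d.
module Submission where

open import Defs
open import Data.Nat using (ℕ; zero; suc; _+_; _≤_; _<_; z≤n; s≤s; _≟_)
open import Data.Nat.Properties
  using (≤-refl; ≤-trans; ≤-reflexive; ≤-pred; <⇒≢; ≤∧≢⇒<; +-assoc; +-mono-≤; +-suc; +-comm;
         suc-injective; +-commutativeSemigroup)
open import Data.Nat.Induction using (<-wellFounded)
open import Algebra.Properties.CommutativeSemigroup +-commutativeSemigroup using (x∙yz≈y∙xz)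
open import Data.Fin using (Fin)
import Data.Fin as F
import Data.Fin.Properties as F
open import Data.Fin.Permutation.Components using (transpose; transpose-inverse)
open import Data.Empty using (⊥-elim)
open import Data.Product using (_×_; _,_; ∃-syntax; Σ-syntax; proj₁)
open import Data.List using (List; []; _∷_; length; map)
open import Data.List.Properties using (length-map; length-removeAt′)
open import Data.List.Relation.Unary.All using (All; []; _∷_)
import Data.List.Relation.Unary.All as All
open import Data.List.Relation.Unary.Any.Properties using (lookup-result)
open import Data.List.Relation.Unary.All.Properties using (¬Any⇒All¬; ─⁺; map⁺)
open import Data.List.Relation.Unary.AllPairs using (AllPairs; []; _∷_)
import Data.List.Relation.Unary.AllPairs as AllPairs
import Data.List.Relation.Unary.AllPairs.Properties as AllPairs
open import Data.List.Relation.Unary.Any using (Any; here; there; any?; _─_; index)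
import Data.List.Relation.Unary.Any as Any
open import Data.List.Membership.Propositional using (_∈_; find)
open import Data.List.Membership.Propositional.Properties using (∈-length)
open import Data.List.Relation.Unary.Unique.Propositional using (Unique)
open import Function using (_∘_)
open import Function.Definitions using (Injective)
open import Induction.WellFounded using (Acc; acc)
open import Relation.Binary.Definitions using (Symmetric)
open import Relation.Binary.PropositionalEquality
open import Relation.Nullary using (¬_; yes; no)
open import Relation.Nullary.Decidable using (dec-true)
open import Relation.Unary using (Decidable)

Σfin-cong : ∀ n {f g : Fin n → ℕ} → (∀ j → f j ≡ g j) → Σfin n f ≡ Σfin n g
Σfin-cong zero    f≡g = refl
Σfin-cong (suc n) f≡g = cong₂ _+_ (f≡g F.zero) (Σfin-cong n (f≡g ∘ F.suc))

Σfin-zero : ∀ n → Σfin n (λ _ → 0) ≡ 0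
Σfin-zero zero    = refl
Σfin-zero (suc n) = Σfin-zero n

Σfin-mono : ∀ n {f g : Fin n → ℕ} → (∀ j → f j ≤ g j) → Σfin n f ≤ Σfin n g
Σfin-mono zero    f≤g = z≤n
Σfin-mono (suc n) f≤g = +-mono-≤ (f≤g F.zero) (Σfin-mono n (f≤g ∘ F.suc))

Σfin-mono-except : ∀ {n} {f g : Fin n → ℕ} {a b} j → (∀ i → i ≢ j → f i ≤ g i) →
                   a + f j ≤ b + g j → a + Σfin n f ≤ b + Σfin n g
Σfin-mono-except {suc n} {f} {g} {a} {b} F.zero f≤g at-j = begin
  a + (f F.zero + Σfin n (f ∘ F.suc))  ≡⟨ +-assoc a _ _ ⟨
  a + f F.zero + Σfin n (f ∘ F.suc)    ≤⟨ +-mono-≤ at-j (Σfin-mono n (λ i → f≤g (F.suc i) λ ())) ⟩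
  b + g F.zero + Σfin n (g ∘ F.suc)    ≡⟨ +-assoc b _ _ ⟩
  b + (g F.zero + Σfin n (g ∘ F.suc))  ∎
  where open Data.Nat.Properties.≤-Reasoning
Σfin-mono-except {suc n} {f} {g} {a} {b} (F.suc j) f≤g at-j = begin
  a + (f F.zero + Σfin n (f ∘ F.suc))  ≡⟨ x∙yz≈y∙xz a (f F.zero) _ ⟩
  f F.zero + (a + Σfin n (f ∘ F.suc))  ≤⟨ +-mono-≤ (f≤g F.zero λ ()) rest ⟩
  g F.zero + (b + Σfin n (g ∘ F.suc))  ≡⟨ x∙yz≈y∙xz (g F.zero) b _ ⟩
  b + (g F.zero + Σfin n (g ∘ F.suc))  ∎
  where
  open Data.Nat.Properties.≤-Reasoning
  rest : a + Σfin n (f ∘ F.suc) ≤ b + Σfin n (g ∘ F.suc)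
  rest = Σfin-mono-except j (λ i i≢j → f≤g (F.suc i) (i≢j ∘ F.suc-injective)) at-j

Σfin-positive : ∀ n {f : Fin n → ℕ} → 0 < Σfin n f → ∃[ j ] 0 < f j
Σfin-positive (suc n) {f} Σ>0 with f F.zero in f₀≡
... | suc _ = F.zero , subst (0 <_) (sym f₀≡) (s≤s z≤n)
... | zero  = let j , fj>0 = Σfin-positive n Σ>0 in F.suc j , fj>0

mismatch : ∀ {m} → Fin m → Fin m → ℕ
mismatch a b with a F.≟ b
... | yes _ = 0
... | no  _ = 1

mismatch-refl : ∀ {m} (a : Fin m) → mismatch a a ≡ 0
mismatch-refl a with a F.≟ a
... | yes _  = refl
... | no a≢a = ⊥-elim (a≢a refl)

mismatch-≢ : ∀ {m} {a b : Fin m} → a ≢ b → mismatch a b ≡ 1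
mismatch-≢ {a = a} {b} a≢b with a F.≟ b
... | yes a≡b = ⊥-elim (a≢b a≡b)
... | no  _   = refl

mismatch-positive⇒≢ : ∀ {m} {a b : Fin m} → 0 < mismatch a b → a ≢ b
mismatch-positive⇒≢ {a = a} {b} m>0 with a F.≟ b
... | no a≢b = a≢b

mismatch≤1 : ∀ {m} (a b : Fin m) → mismatch a b ≤ 1
mismatch≤1 a b with a F.≟ b
... | yes _ = z≤n
... | no  _ = s≤s z≤n

mismatch-sym : ∀ {m} (a b : Fin m) → mismatch a b ≡ mismatch b a
mismatch-sym a b with a F.≟ b | b F.≟ a
... | yes _    | yes _    = refl
... | no  _    | no  _    = refl
... | yes refl | no a≢a   = ⊥-elim (a≢a refl)
... | no  a≢b  | yes refl = ⊥-elim (a≢b refl)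

mismatch-injective : ∀ {m n} {f : Fin m → Fin n} → Injective _≡_ _≡_ f →
                     ∀ a b → mismatch (f a) (f b) ≡ mismatch a b
mismatch-injective {f = f} f-inj a b with f a F.≟ f b | a F.≟ b
... | yes _   | yes _    = refl
... | no  _   | no  _    = refl
... | no  f≢f | yes refl = ⊥-elim (f≢f refl)
... | yes fa≡fb | no a≢b = ⊥-elim (a≢b (f-inj fa≡fb))

transpose-injective : ∀ {m} (u v : Fin m) → Injective _≡_ _≡_ (transpose u v)
transpose-injective u v {a} {b} eq = begin
  a                                 ≡⟨ transpose-inverse v u ⟨
  transpose v u (transpose u v a)   ≡⟨ cong (transpose v u) eq ⟩
  transpose v u (transpose u v b)   ≡⟨ transpose-inverse v u ⟩
  b                                 ∎
  where open ≡-Reasoning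

transpose-sends : ∀ {m} (u v : Fin m) → transpose u v u ≡ v
transpose-sends u v rewrite dec-true (u F.≟ u) refl = refl

diffCount≡Σmismatch : ∀ m {n} (w x : Fin m → Fin n) →
                      diffCount m (λ _ → F._≟_) w x ≡ Σfin m (λ t → mismatch (w t) (x t))
diffCount≡Σmismatch zero    w x = refl
diffCount≡Σmismatch (suc m) w x with w F.zero F.≟ x F.zero
... | yes _ = diffCount≡Σmismatch m (w ∘ F.suc) (x ∘ F.suc)
... | no  _ = cong suc (diffCount≡Σmismatch m (w ∘ F.suc) (x ∘ F.suc))

module _ {s : ℕ} {k α : Fin s → ℕ} where

  private
    W : Set
    W = Word s k α

  hamming≡Σmismatch : (w x : W) →
    hamming w x ≡ Σfin s (λ i → Σfin (α i) (λ t → mismatch (w i t) (x i t)))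
  hamming≡Σmismatch w x = Σfin-cong s (λ i → diffCount≡Σmismatch (α i) (w i) (x i))

  hamming-cong : ∀ {w x w′ x′ : W} →
    (∀ i t → mismatch (w i t) (x i t) ≡ mismatch (w′ i t) (x′ i t)) → hamming w x ≡ hamming w′ x′
  hamming-cong {w} {x} {w′} {x′} eq = begin
    hamming w x                                                   ≡⟨ hamming≡Σmismatch w x ⟩
    Σfin s (λ i → Σfin (α i) (λ t → mismatch (w i t) (x i t)))      ≡⟨ Σfin-cong s (λ i → Σfin-cong (α i) (eq i)) ⟩
    Σfin s (λ i → Σfin (α i) (λ t → mismatch (w′ i t) (x′ i t)))    ≡⟨ hamming≡Σmismatch w′ x′ ⟨
    hamming w′ x′                                                 ∎
    where open ≡-Reasoning

  hamming-sym : (w x : W) → hamming w x ≡ hamming x w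
  hamming-sym w x = hamming-cong (λ i t → mismatch-sym (w i t) (x i t))

  hamming-refl : (w : W) → hamming w w ≡ 0
  hamming-refl w = trans (hamming≡Σmismatch w w)
    (trans (Σfin-cong s (λ i → trans (Σfin-cong (α i) (λ t → mismatch-refl (w i t))) (Σfin-zero (α i))))
           (Σfin-zero s))

  hamming-positive⇒differ : (w x : W) → 0 < hamming w x → ∃[ i ] ∃[ t ] w i t ≢ x i t
  hamming-positive⇒differ w x d>0 with Σfin-positive s (subst (0 <_) (hamming≡Σmismatch w x) d>0)
  ... | i , Σᵢ>0 with Σfin-positive (α i) Σᵢ>0
  ... | t , m>0 = i , t , mismatch-positive⇒≢ m>0

  AgreeExceptAt : (i : Fin s) → Fin (α i) → W → W → Set
  AgreeExceptAt i t w w′ =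
    (∀ i′ → i′ ≢ i → ∀ t′ → w i′ t′ ≡ w′ i′ t′) × (∀ t′ → t′ ≢ t → w i t′ ≡ w′ i t′)

  AgreeExceptAt-sym : ∀ {i t w w′} → AgreeExceptAt i t w w′ → AgreeExceptAt i t w′ w
  AgreeExceptAt-sym (other-blocks , same-block) =
    (λ i′ i′≢i t′ → sym (other-blocks i′ i′≢i t′)) , (λ t′ t′≢t → sym (same-block t′ t′≢t))

  hamming-mono-except : ∀ {a b} i t {w w′} (x : W) → AgreeExceptAt i t w w′ →
    a + mismatch (w i t) (x i t) ≤ b + mismatch (w′ i t) (x i t) → a + hamming w x ≤ b + hamming w′ x
  hamming-mono-except {a} {b} i t {w} {w′} x (other-blocks , same-block) at-it =
    subst₂ (λ p q → a + p ≤ b + q) (sym (hamming≡Σmismatch w x)) (sym (hamming≡Σmismatch w′ x))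
      (Σfin-mono-except i
        (λ i′ i′≢i → Σfin-mono (α i′) (λ t′ → agreeing (other-blocks i′ i′≢i t′)))
        (Σfin-mono-except t (λ t′ t′≢t → agreeing (same-block t′ t′≢t)) at-it))
    where
    agreeing : ∀ {i′} {t′ : Fin (α i′)} {u v} → u ≡ v → mismatch u (x i′ t′) ≤ mismatch v (x i′ t′)
    agreeing refl = ≤-refl

  relabelAt : (i : Fin s) (t : Fin (α i)) → (Fin (k i) → Fin (k i)) → W → W
  relabelAt i t f w i′ t′ with i F.≟ i′
  ... | no  _    = w i′ t′
  ... | yes refl with t F.≟ t′
  ...   | no  _    = w i t′
  ...   | yes refl = f (w i t)

  relabelAt-at : ∀ i t f (w : W) → relabelAt i t f w i t ≡ f (w i t)
  relabelAt-at i t f w with i F.≟ i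
  ... | no  i≢i  = ⊥-elim (i≢i refl)
  ... | yes refl with t F.≟ t
  ...   | no  t≢t  = ⊥-elim (t≢t refl)
  ...   | yes refl = refl

  relabelAt-agreeExceptAt : ∀ i t f (w : W) → AgreeExceptAt i t w (relabelAt i t f w)
  relabelAt-agreeExceptAt i t f w = other-blocks , same-block
    where
    other-blocks : ∀ i′ → i′ ≢ i → ∀ t′ → w i′ t′ ≡ relabelAt i t f w i′ t′
    other-blocks i′ i′≢i t′ with i F.≟ i′
    ... | no  _    = refl
    ... | yes refl = ⊥-elim (i′≢i refl)
    same-block : ∀ t′ → t′ ≢ t → w i t′ ≡ relabelAt i t f w i t′
    same-block t′ t′≢t with i F.≟ i
    ... | no  i≢i  = ⊥-elim (i≢i refl)
    ... | yes refl with t F.≟ t′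
    ...   | no  _    = refl
    ...   | yes refl = ⊥-elim (t′≢t refl)

  mismatch-relabelAt : ∀ i t {f} → Injective _≡_ _≡_ f → ∀ (w x : W) i′ t′ →
    mismatch (relabelAt i t f w i′ t′) (relabelAt i t f x i′ t′) ≡ mismatch (w i′ t′) (x i′ t′)
  mismatch-relabelAt i t f-inj w x i′ t′ with i F.≟ i′
  ... | no  _    = refl
  ... | yes refl with t F.≟ t′
  ...   | no  _    = refl
  ...   | yes refl = mismatch-injective f-inj (w i t) (x i t)

  hamming-relabelAt : ∀ i t {f} → Injective _≡_ _≡_ f → (w x : W) →
    hamming (relabelAt i t f w) (relabelAt i t f x) ≡ hamming w x
  hamming-relabelAt i t f-inj w x = hamming-cong (mismatch-relabelAt i t f-inj w x)

  hamming-relabelAt-≤ : ∀ i t f (w x : W) → hamming w x ≤ suc (hamming (relabelAt i t f w) x)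
  hamming-relabelAt-≤ i t f w x =
    hamming-mono-except {0} {1} i t x (relabelAt-agreeExceptAt i t f w)
      (≤-trans (mismatch≤1 (w i t) (x i t)) (s≤s z≤n))

  hamming-relabelAt-< : ∀ i t f (w x : W) → w i t ≢ x i t → f (w i t) ≡ x i t →
    hamming (relabelAt i t f w) x < hamming w x
  hamming-relabelAt-< i t f w x w≢x f-hits =
    hamming-mono-except {1} {0} i t x (AgreeExceptAt-sym (relabelAt-agreeExceptAt i t f w))
      (≤-reflexive (begin
        1 + mismatch (relabelAt i t f w i t) (x i t)  ≡⟨ cong (λ z → 1 + mismatch z (x i t))
                                                          (trans (relabelAt-at i t f w) f-hits) ⟩
        1 + mismatch (x i t) (x i t)                 ≡⟨ cong suc (mismatch-refl (x i t)) ⟩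
        1                                            ≡⟨ mismatch-≢ w≢x ⟨
        mismatch (w i t) (x i t)                     ∎))
    where open ≡-Reasoning

  Walk-mono : ∀ {d} {C C′ : Code s k α} → (∀ {w} → w ∈ elems C → w ∈ elems C′) →
              ∀ {a b} → Walk C d a b → Walk C′ d a b
  Walk-mono C⊆C′ (here a∈C)             = here (C⊆C′ a∈C)
  Walk-mono C⊆C′ (step (a∈C , b∈C , e) walk) = step (C⊆C′ a∈C , C⊆C′ b∈C , e) (Walk-mono C⊆C′ walk)

  Walk-trans : ∀ {d} {C : Code s k α} {a b c} → Walk C d a b → Walk C d b c → Walk C d a c
  Walk-trans (here _)        walk′ = walk′
  Walk-trans (step edge walk) walk′ = step edge (Walk-trans walk walk′)

  connected-∷ : ∀ {d x L b} (u : Unique L) (u′ : Unique (x ∷ L)) → b ∈ L → hamming x b ≡ d →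
    ContactGraphConnected (code L u) d → ContactGraphConnected (code (x ∷ L) u′) d
  connected-∷ {d} {x} {L} {b} u u′ b∈L xb≡d connected = connected′
    where
    weaken : ∀ {a c} → Walk (code L u) d a c → Walk (code (x ∷ L) u′) d a c
    weaken = Walk-mono there
    connected′ : ContactGraphConnected (code (x ∷ L) u′) d
    connected′ _ _ (here refl) (here refl) = here (here refl)
    connected′ _ c (here refl) (there c∈L) =
      step (here refl , there b∈L , xb≡d) (weaken (connected b c b∈L c∈L))
    connected′ a _ (there a∈L) (here refl) =
      Walk-trans (weaken (connected a b a∈L b∈L))
                 (step (there b∈L , here refl , trans (hamming-sym b x) xb≡d) (here (here refl)))
    connected′ a c (there a∈L) (there c∈L) = weaken (connected a c a∈L c∈L)

AllPairs-─ : ∀ {A : Set} {R : A → A → Set} {P : A → Set} → Symmetric R →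
  ∀ {xs} (p : Any P xs) → AllPairs R xs → All (R (Any.lookup p)) (xs ─ p) × AllPairs R (xs ─ p)
AllPairs-─ R-sym (here _)  (Rx ∷ pairs) = Rx , pairs
AllPairs-─ R-sym (there p) (Rx ∷ pairs) =
  let Rp , pairs′ = AllPairs-─ R-sym p pairs
  in R-sym (proj₁ (All.lookupAny Rx p)) ∷ Rp , ─⁺ p Rx ∷ pairs′

two-distinct⇒2≤length : ∀ {A : Set} {L : List A} {w x} → w ∈ L → x ∈ L → w ≢ x → 2 ≤ length L
two-distinct⇒2≤length (here refl) (here refl) w≢x = ⊥-elim (w≢x refl)
two-distinct⇒2≤length (here refl) (there x∈L) _   = s≤s (∈-length x∈L)
two-distinct⇒2≤length (there w∈L) _           _   = s≤s (∈-length w∈L)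

module _ {s : ℕ} {k α : Fin s → ℕ} (d : ℕ) where

  private
    W : Set
    W = Word s k α

  Far : W → W → Set
  Far a b = d ≤ hamming a b

  Far-sym : ∀ {a b} → Far a b → Far b a
  Far-sym {a} {b} = subst (d ≤_) (hamming-sym a b)

  Separated : List W → Set
  Separated = AllPairs Far

  FarApart : List W → List W → Set
  FarApart R B = All (λ r → All (Far r) B) R

  Touches : List W → W → Set
  Touches B x = Any (λ b → hamming x b ≡ d) B

  touches? : ∀ B → Decidable (Touches B)
  touches? B x = any? (λ b → hamming x b ≟ d) B

  farApart-untouched : ∀ {R B} → FarApart R B → ¬ Any (Touches B) R →
                       All (λ r → All (λ b → d < hamming r b) B) R
  farApart-untouched far ¬touch = All.zipWith
    (λ (r-far , r-untouched) → All.zipWith (λ (rb-far , rb≢d) → ≤∧≢⇒< rb-far (rb≢d ∘ sym))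
                                           (r-far , ¬Any⇒All¬ _ r-untouched))
    (far , ¬Any⇒All¬ _ ¬touch)

  step-closer : ∀ c R {b B} → b ∈ B → Separated (c ∷ R) →
    All (λ r → All (λ b → d < hamming r b) B) (c ∷ R) →
    Σ[ σ ∈ (W → W) ] (Separated (map σ (c ∷ R)) × FarApart (map σ (c ∷ R)) B × hamming (σ c) b < hamming c b)
  step-closer c R {b} {B} b∈B sep strict
    with hamming-positive⇒differ c b (≤-trans (s≤s z≤n) (All.lookup (All.head strict) b∈B))
  ... | i , t , c≢b = σ , separated′ , farApart′ , closer
    where
    f : Fin (k i) → Fin (k i)
    f = transpose (c i t) (b i t)
    σ : W → W
    σ = relabelAt i t f
    separated′ : Separated (map σ (c ∷ R))
    separated′ = AllPairs.map⁺ (AllPairs.map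
      (λ {u} {v} → subst (d ≤_) (sym (hamming-relabelAt i t (transpose-injective (c i t) (b i t)) u v))) sep)
    farApart′ : FarApart (map σ (c ∷ R)) B
    farApart′ = map⁺ (All.map (All.map (λ {x} r-far → ≤-pred (≤-trans r-far (hamming-relabelAt-≤ i t f _ x))))
                              strict)
    closer : hamming (σ c) b < hamming c b
    closer = hamming-relabelAt-< i t f c b c≢b (transpose-sends (c i t) (b i t))

  attach : ∀ c R {b B} → b ∈ B → Separated (c ∷ R) → FarApart (c ∷ R) B → Acc _<_ (hamming c b) →
    Σ[ R′ ∈ List W ] (length R′ ≡ suc (length R) × Separated R′ × FarApart R′ B × Any (Touches B) R′)
  attach c R {b} {B} b∈B sep far (acc closer-accessible) with any? (touches? B) (c ∷ R)
  ... | yes touch  = c ∷ R , refl , sep , far , touch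
  ... | no ¬touch =
    let σ , sep′ , far′ , closer = step-closer c R b∈B sep (farApart-untouched far ¬touch)
        R′ , length-R′ , rest = attach (σ c) (map σ R) b∈B sep′ far′ (closer-accessible closer)
    in R′ , trans length-R′ (cong suc (length-map σ R)) , rest

  module _ (1≤d : 1 ≤ d) where

    Far⇒≢ : ∀ {a b} → Far a b → a ≢ b
    Far⇒≢ {a} far refl = <⇒≢ (≤-trans 1≤d far) (sym (hamming-refl a))

    separatedCode : (L : List W) → Separated L → Code s k α
    separatedCode L sep = code L (AllPairs.map Far⇒≢ sep)

    grow : ∀ n R {b B} → length R ≡ n → b ∈ B → (sepB : Separated B) →
      ContactGraphConnected (separatedCode B sepB) d → Separated R → FarApart R B →
      Σ[ L ∈ List W ] Σ[ sepL ∈ Separated L ]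
        (length L ≡ length R + length B × ContactGraphConnected (separatedCode L sepL) d)
    grow _ [] {B = B} _ _ sepB connected _ _ = B , sepB , refl , connected
    grow (suc n) (c ∷ R) {B = B} length-R b∈B sepB connected sepR far
      with attach c R b∈B sepR far (<-wellFounded _)
    ... | R′ , length-R′ , sepR′ , farR′ , touch =
      let x-far , sep─ = AllPairs-─ Far-sym touch sepR′
          x = Any.lookup touch
          b′ , b′∈B , xb′≡d = find (lookup-result touch)
          sepB′ : Separated (x ∷ B)
          sepB′ = proj₁ (All.lookupAny farR′ touch) ∷ sepB
          L , sepL , length-L , connected′ =
            grow n (R′ ─ touch) length-─ (here refl) sepB′
              (connected-∷ _ _ b′∈B xb′≡d connected) sep─
              (All.zipWith (λ (x-far , r-far) → Far-sym x-far ∷ r-far) (x-far , ─⁺ touch farR′))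
      in L , sepL , trans length-L (length-moved (length B)) , connected′
      where
      open ≡-Reasoning
      length-moved : ∀ m → length (R′ ─ touch) + suc m ≡ suc (length R) + m
      length-moved m = begin
        length (R′ ─ touch) + suc m    ≡⟨ +-suc _ m ⟩
        suc (length (R′ ─ touch)) + m  ≡⟨ cong (_+ m) (length-removeAt′ R′ (index touch)) ⟨
        length R′ + m                  ≡⟨ cong (_+ m) length-R′ ⟩
        suc (length R) + m             ∎
      length-─ : length (R′ ─ touch) ≡ n
      length-─ = suc-injective (trans (sym (length-removeAt′ R′ (index touch))) (trans length-R′ length-R))

    connected-rearrangement : ∀ c R → Separated (c ∷ R) →
      Σ[ L ∈ List W ] Σ[ sepL ∈ Separated L ]
        (length L ≡ suc (length R) × ContactGraphConnected (separatedCode L sepL) d)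
    connected-rearrangement c R (c-far ∷ sepR) =
      let L , sepL , length-L , connected = grow (length R) R refl (here refl) ([] ∷ []) singleton sepR
                                                 (All.map (λ c-far → Far-sym c-far ∷ []) c-far)
      in L , sepL , trans length-L (+-comm (length R) 1) , connected
      where
      singleton : ContactGraphConnected (separatedCode (c ∷ []) ([] ∷ [])) d
      singleton _ _ (here refl) (here refl) = here (here refl)

    contact-of-connected : (C : Code s k α) → 2 ≤ card C → ContactGraphConnected C d →
      ∃[ w ] ∃[ x ] (w ∈ elems C × x ∈ elems C × w ≢ x × hamming w x ≡ d)
    contact-of-connected (code (_ ∷ []) _) (s≤s ()) _
    contact-of-connected (code (a ∷ b ∷ _) (a∉ ∷ _)) _ connected
      with connected a b (here refl) (there (here refl))
    ... | here _ = ⊥-elim (All.head a∉ refl)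
    ... | step (a∈C , b′∈C , ab′≡d) _ =
      a , _ , a∈C , b′∈C , (λ { refl → Far⇒≢ (≤-reflexive (sym ab′≡d)) refl }) , ab′≡d

  separated⁺ : ∀ {L} → Unique L → (∀ w x → w ∈ L → x ∈ L → w ≢ x → Far w x) → Separated L
  separated⁺ []        _   = []
  separated⁺ (w∉ ∷ u) far =
    All.tabulate (λ x∈L → far _ _ (here refl) (there x∈L) (All.lookup w∉ x∈L))
    ∷ separated⁺ u (λ w x w∈L x∈L → far w x (there w∈L) (there x∈L))

  separated⁻ : ∀ {L} → Separated L → ∀ w x → w ∈ L → x ∈ L → w ≢ x → Far w x
  separated⁻ (w-far ∷ _)   _ _ (here refl)  (here refl)  w≢x = ⊥-elim (w≢x refl)
  separated⁻ (w-far ∷ _)   _ _ (here refl)  (there x∈L)  _   = All.lookup w-far x∈L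
  separated⁻ (x-far ∷ _)   _ _ (there w∈L)  (here refl)  _   = Far-sym (All.lookup x-far w∈L)
  separated⁻ (_ ∷ sep)     w x (there w∈L)  (there x∈L)  w≢x = separated⁻ sep w x w∈L x∈L w≢x

proposition1 : (s : ℕ) → 1 ≤ s → (k α : Fin s → ℕ) →
    (∀ i → 2 ≤ k i) →
    (∀ i j → i Data.Fin.< j → k i Data.Nat.< k j) →
    (∀ i → 1 ≤ α i) →
    (d : ℕ) → 1 ≤ d →
    (C : Code s k α) → IsHammingPacking C d →
    Σ[ C′ ∈ Code s k α ] (IsHammingPacking C′ d × card C′ ≡ card C × ContactGraphConnected C′ d)
proposition1 s _ k α _ _ _ d 1≤d (code [] _) ((_ , _ , _ , () , _) , _)
proposition1 s _ k α _ _ _ d 1≤d (code (c ∷ R) u) ((far , w , x , w∈C , x∈C , w≢x , _) , maximal)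
  with connected-rearrangement d 1≤d c R (separated⁺ d u far)
... | L , sepL , length-L , connected =
  C′ , ((separated⁻ d sepL , contact) , packing) , length-L , connected
  where
  C′ : Code s k α
  C′ = separatedCode d 1≤d L sepL
  contact : ∃[ w ] ∃[ x ] (w ∈ L × x ∈ L × w ≢ x × hamming w x ≡ d)
  contact = contact-of-connected d 1≤d C′
    (subst (2 ≤_) (sym length-L) (two-distinct⇒2≤length w∈C x∈C w≢x)) connected
  packing : (D : Code s k α) → HasMinDist D d → card D ≤ card C′
  packing D D-min = subst (card D ≤_) (sym length-L) (maximal D D-min)
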